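{- Let $\mathcal B$ be a pre-matroid on a finite set $X$ and let $\omega,\pi,a,z,\varepsilon$ be as in the context. If $B\in\mathcal B$ is not a branching image, then $\varphi_\omega^{ -1}(B)=\varphi_\pi^{ -1}(B)$.
   Context: A pre-matroid on a finite set $X$ is a non-empty set $\mathcal B$ of subsets of $X$ (bases). For $Y\subseteq X$, $x\notin Y$, $Y+x=Y\cup\{x\}$; for $y\in Y$, $Y-y=Y\setminus\{y\}$. An almost-basis is $B-x$ with $B\in\mathcal B$, $x\in B$; $U(D)=\{x\notin D: D+x\in\mathcal B\}$. For a linear order $\rho$ on $X$ and an almost-basis $D$, $\varphi_\rho(D)=D+\min_\rho U(D)$. Let $\omega$ be a linear order on $X$, $a\ne z$ consecutive for $\omega$ with $a<_\omega z$, $\varepsilon$ the transposition exchanging $a,z$, and $\pi$ the linear order agreeing with $\omega$ except $z<_\pi a$. An almost-basis $A$ is branching if $\varphi_\omega(A)\ne\varphi_\pi(A)$. A basis $B$ is a branching image if $B=\varphi_\omega(A)$ or $B=\varphi_\pi(A)$ for some branching almost-basis $A$. -}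

module Defs where

open import Level using (0ℓ)
open import Data.Nat using (ℕ; suc)
open import Data.Fin using (Fin; toℕ; _≟_; _≤_)
open import Data.Fin.Subset using (Subset; _∈_; _∉_; _∪_; _∩_; ∁; ⁅_⁆)
open import Data.Product using (Σ; ∃; ∃-syntax; _×_; _,_)
open import Data.Sum using (_⊎_)
open import Relation.Nullary using (¬_; yes; no)
open import Relation.Unary using (Pred; Decidable)
open import Relation.Binary.PropositionalEquality using (_≡_; _≢_)
open import Function.Definitions using (Injective)

-- A linear order on X = Fin n is represented by its rank function
-- (an injection Fin n → Fin n, hence a bijection):  x ≤_ρ y  iff  ρ x ≤ ρ y.
record LinOrder (n : ℕ) : Set where
  constructor linOrder
  field
    rank   : Fin n → Fin n
    rankInj : Injective _≡_ _≡_ rank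
open LinOrder public

record PreMatroid (n : ℕ) : Set₁ where
  field
    IsBasis  : Pred (Subset n) 0ℓ
    basis?   : Decidable IsBasis
    nonEmpty : ∃[ B ] IsBasis B
open PreMatroid public

module _ {n : ℕ} where

  _+ₛ_ : Subset n → Fin n → Subset n
  Y +ₛ x = Y ∪ ⁅ x ⁆

  _-ₛ_ : Subset n → Fin n → Subset n
  Y -ₛ y = Y ∩ ∁ ⁅ y ⁆

  transp : Fin n → Fin n → Fin n → Fin n
  transp a z x with x ≟ a
  ... | yes _ = z
  ... | no _ with x ≟ z
  ...   | yes _ = a
  ...   | no _  = x

  module _ (M : PreMatroid n) where

    AlmostBasis : Subset n → Set
    AlmostBasis D = ∃[ B ] ∃[ x ] (IsBasis M B × x ∈ B × D ≡ B -ₛ x)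

    U : Subset n → Pred (Fin n) 0ℓ
    U D x = x ∉ D × IsBasis M (D +ₛ x)

    IsMin : LinOrder n → Pred (Fin n) 0ℓ → Fin n → Set
    IsMin ρ P x = P x × (∀ y → P y → rank ρ x ≤ rank ρ y)

    -- φ_ρ(D) = B  (φ_ρ defined on almost-bases, φ_ρ(D) = D + min_ρ U(D))
    PhiIs : LinOrder n → Subset n → Subset n → Set
    PhiIs ρ D B = AlmostBasis D × ∃[ x ] (IsMin ρ (U D) x × B ≡ D +ₛ x)

    module _ (ω π : LinOrder n) where

      Branching : Subset n → Set
      Branching A = AlmostBasis A ×
        ∃[ B₁ ] ∃[ B₂ ] (PhiIs ω A B₁ × PhiIs π A B₂ × B₁ ≢ B₂)

      BranchingImage : Subset n → Set
      BranchingImage B = ∃[ A ] (Branching A × (PhiIs ω A B ⊎ PhiIs π A B))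

Consecutive : {n : ℕ} → LinOrder n → Fin n → Fin n → Set
Consecutive ω a z = toℕ (rank ω z) ≡ suc (toℕ (rank ω a))

-- π: agrees with ω except z <_π a, i.e. rank_π = rank_ω ∘ ε
IsSwapOf : {n : ℕ} → LinOrder n → LinOrder n → Fin n → Fin n → Set
IsSwapOf π ω a z = ∀ x → rank π x ≡ rank ω (transp a z x)

module Submission where

open import Defs
open import Level using (0ℓ)
open import Data.Nat using (ℕ)
open import Data.Fin using (Fin; _≤_)
open import Data.Fin.Properties using (≤-totalOrder)
open import Data.Fin.Subset using (Subset)
open import Data.Fin.Subset.Properties using (_∈?_)
open import Data.Bool using () renaming (_≟_ to _≟ᵇ_)
open import Data.Vec.Properties using (≡-dec)
open import Data.List using (allFin; filter)
open import Data.List.Relation.Unary.All using (lookup)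
open import Data.List.Relation.Unary.All.Properties using (all-filter)
open import Data.List.Membership.Propositional.Properties using (∈-allFin; ∈-filter⁺)
open import Data.Product using (∃-syntax; _×_; _,_)
open import Data.Sum using (inj₁; inj₂)
open import Relation.Nullary using (¬_; yes; no; contradiction)
open import Relation.Unary using (Pred; Decidable)
open import Relation.Binary.PropositionalEquality using (refl; sym; _≢_)

module _ {n : ℕ} (ρ : LinOrder n) {P : Pred (Fin n) 0ℓ} (P? : Decidable P) where

  open import Data.List.Extrema (≤-totalOrder n)
    using (argmin; argmin-all; f[argmin]≤f[xs])

  ∃-rank-minimum : ∀ {x} → P x → ∃[ m ] (P m × ∀ y → P y → rank ρ m ≤ rank ρ y)
  ∃-rank-minimum {x} Px = m , argmin-all (rank ρ) Px (all-filter P? (allFin n)) , minimal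
    where
    candidates = filter P? (allFin n)
    m = argmin (rank ρ) x candidates

    minimal : ∀ y → P y → rank ρ m ≤ rank ρ y
    minimal y Py = lookup (f[argmin]≤f[xs] x candidates) (∈-filter⁺ P? (∈-allFin y) Py)

module _ {n : ℕ} (M : PreMatroid n) where

  U? : (D : Subset n) → Decidable (U M D)
  U? D y with y ∈? D | basis? M (D +ₛ y)
  ... | yes y∈D | _        = no λ (y∉D , _) → y∉D y∈D
  ... | no y∉D  | yes D+y  = yes (y∉D , D+y)
  ... | no _    | no ¬D+y  = no λ (_ , D+y) → ¬D+y D+y

  -- The domain of φ_ρ, the almost-bases D with U(D) non-empty, does not depend on ρ.
  PhiIs-defined : (ρ σ : LinOrder n) {D B : Subset n} → PhiIs M ρ D B → ∃[ B′ ] PhiIs M σ D B′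
  PhiIs-defined ρ σ {D} (almost , x , (Ux , _) , _) with ∃-rank-minimum σ (U? D) Ux
  ... | m , isMin = D +ₛ m , almost , m , isMin , refl

  module _ (ω π : LinOrder n) {B : Subset n} (¬image : ¬ BranchingImage M ω π B) {D : Subset n} where

    PhiIs-ω⇒π : PhiIs M ω D B → PhiIs M π D B
    PhiIs-ω⇒π φωD≡B@(almost , _) with PhiIs-defined ω π φωD≡B
    ... | B′ , φπD≡B′ with ≡-dec _≟ᵇ_ B′ B
    ...   | yes refl = φπD≡B′
    ...   | no B′≢B  = contradiction
              (D , (almost , B , B′ , φωD≡B , φπD≡B′ , λ B≡B′ → B′≢B (sym B≡B′)) , inj₁ φωD≡B) ¬image

    PhiIs-π⇒ω : PhiIs M π D B → PhiIs M ω D B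
    PhiIs-π⇒ω φπD≡B@(almost , _) with PhiIs-defined π ω φπD≡B
    ... | B′ , φωD≡B′ with ≡-dec _≟ᵇ_ B′ B
    ...   | yes refl = φωD≡B′
    ...   | no B′≢B  = contradiction (D , (almost , B′ , B , φωD≡B′ , φπD≡B , B′≢B) , inj₂ φπD≡B) ¬image

lemma8p6 : {n : ℕ} (M : PreMatroid n) (ω π : LinOrder n) (a z : Fin n) →
    a ≢ z → Consecutive ω a z → IsSwapOf π ω a z →
    (B : Subset n) → IsBasis M B → ¬ BranchingImage M ω π B →
    (D : Subset n) → (PhiIs M ω D B → PhiIs M π D B) × (PhiIs M π D B → PhiIs M ω D B)
lemma8p6 M ω π _ _ _ _ _ _ _ ¬image _ = PhiIs-ω⇒π M ω π ¬image , PhiIs-π⇒ω M ω π ¬image
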